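{- Let $r\ge2$, let $n_1,\dots,n_r$ be nonnegative integers and let $z_1,\dots,z_r\in\mathbb{C}$. Then \[ \zeta_r(-n_1,\dots,-n_r;z_1,\dots,z_r)=\frac{(-1)^{n_r}}{n_r+1}\sum_{k=0}^{n_r+1}\binom{n_r+1}{k}(-1)^k\,\zeta_{r-1}(-n_1,\dots,-n_{r-2},-n_{r-1}-k;z_1,\dots,z_{r-1})\,B_{n_r+1-k}(z_r). \]
   Context: Bernoulli numbers $B_m$ are defined by $\frac{t}{e^t-1}=\sum_{m\ge0}B_m\frac{t^m}{m!}$, so $B_1=-\tfrac12$. Bernoulli polynomials are $B_m(z)=\sum_{j=0}^m\binom{m}{j}B_jz^{m-j}$. For positive integers $a_1,\dots,a_k$ and complex $z_1,\dots,z_k$, define recursively $V(a_1;z_1)=B_{a_1}(z_1)/a_1$ and, for $k\ge2$, \[ V(a_1,\dots,a_k;z_1,\dots,z_k)=\frac{1}{a_k}\sum_{j=0}^{a_k}\binom{a_k}{j}B_{a_k-j}(z_k)\,V(a_1,\dots,a_{k-2},a_{k-1}+j;z_1,\dots,z_{k-1}). \] This is the evaluated value of the symbolic product $\prod_{i=1}^k\mathcal{C}^{a_i}_{1,\dots,i}(z_1,\dots,z_i)$, where \[ \mathcal{C}^n_1(z_1)=\frac{(z_1+\mathcal{B}_1)^n}{n},\qquad \mathcal{C}^n_{1,\dots,k+1}=\frac{(\mathcal{C}_{1,\dots,k}+\mathcal{B}_{k+1}+z_{k+1})^n}{n}, \] and $(\mathcal{B}_j+z_j)^m$ is evaluated as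 $B_m(z_j)$. The shifted multiple zeta value at negative integers (the paper's symbolic form of Sadaoui's analytic continuation) is \[ \zeta_r(-n_1,\dots,-n_r;z_1,\dots,z_r)=(-1)^{n_1+\dots+n_r}\,V(n_1+1,\dots,n_r+1;z_1,\dots,z_r) \] for nonnegative integers $n_i$. -}

module Defs where

open import Level using (Level)
open import Data.Nat as ℕ using (ℕ; zero; suc; _≤?_)
open import Data.Nat.Combinatorics using (_C_)
open import Data.Fin using (Fin)
open import Data.Vec.Functional using (init; last; updateAt)
open import Data.Integer using (+_)
open import Data.Rational as ℚ using (ℚ; _/_)
open import Relation.Nullary using (yes; no)
open import Algebra.Bundles using (CommutativeRing)

-- Bernoulli numbers (B_1 = -1/2), via the standard recurrence equivalent to
-- t/(e^t-1) = Σ B_m t^m/m! :  B_0 = 1,  B_m = -(1/(m+1)) Σ_{j<m} C(m+1,j) B_j.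
-- bernTable m j = B_j for j ≤ m.
sumℚ : ℕ → (ℕ → ℚ) → ℚ
sumℚ zero    f = f 0
sumℚ (suc n) f = sumℚ n f ℚ.+ f (suc n)

bernTable : ℕ → ℕ → ℚ
bernTable zero    j = ℚ.1ℚ
bernTable (suc m) j with j ≤? m
... | yes _ = bernTable m j
... | no  _ = ℚ.- (((+ 1) / suc (suc m)) ℚ.*
                sumℚ m (λ i → ((+ (suc (suc m) C i)) / 1) ℚ.* bernTable m i))

bernoulli : ℕ → ℚ
bernoulli m = bernTable m m

-- Everything below lives in a commutative ring R equipped with a map ι : ℚ → R
-- (in the theorem ι is required to be a ring homomorphism, i.e. R is a ℚ-algebra;
-- ℂ is the case of the paper).
module QAlg {c ℓ : Level} (R : CommutativeRing c ℓ) (ι : ℚ → CommutativeRing.Carrier R) where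
  open CommutativeRing R

  sumTo : ℕ → (ℕ → Carrier) → Carrier
  sumTo zero    f = f 0
  sumTo (suc n) f = sumTo n f + f (suc n)

  pow : Carrier → ℕ → Carrier
  pow x zero    = 1#
  pow x (suc n) = x * pow x n

  sgn : ℕ → Carrier
  sgn n = pow (- 1#) n

  nat : ℕ → Carrier
  nat n = ι ((+ n) / 1)

  inv1+ : ℕ → Carrier
  inv1+ n = ι ((+ 1) / suc n)

  bernPoly : ℕ → Carrier → Carrier
  bernPoly m z = sumTo m (λ j → nat (m C j) * ι (bernoulli j) * pow z (m ℕ.∸ j))

  -- V k p z = V(a_1,…,a_{k+1}; z_1,…,z_{k+1}) with a_i = p i + 1 (positive integers).
  V : (k : ℕ) → (Fin (suc k) → ℕ) → (Fin (suc k) → Carrier) → Carrier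
  V zero    p z = inv1+ (p Fin.zero) * bernPoly (suc (p Fin.zero)) (z Fin.zero)
    where import Data.Fin as Fin
  V (suc k) p z = inv1+ (last p) *
    sumTo (suc (last p)) (λ j →
      nat (suc (last p) C j) * bernPoly (suc (last p) ℕ.∸ j) (last z) *
      V k (updateAt (init p) (Data.Fin.fromℕ k) (λ x → x ℕ.+ j)) (init z))

  -- ζ_{k+1}(-n_1,…,-n_{k+1}; z_1,…,z_{k+1}) = (-1)^{n_1+…+n_{k+1}} V(n_1+1,…,n_{k+1}+1; z)
  sumFin : (k : ℕ) → (Fin k → ℕ) → ℕ
  sumFin zero    n = 0
  sumFin (suc k) n = n Fin.zero ℕ.+ sumFin k (λ i → n (Fin.suc i))
    where import Data.Fin as Fin

  zeta : (k : ℕ) → (Fin (suc k) → ℕ) → (Fin (suc k) → Carrier) → Carrier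
  zeta k n z = sgn (sumFin (suc k) n) * V k n z

{-# OPTIONS --safe #-}
-- The defining recursion of V already has the shape of the right-hand side, so
-- only signs need to be matched: (-1)^{n_1+…+n_r} splits as
-- (-1)^{n_r} (-1)^{n_1+…+n_{r-1}}, and the k-th shifted argument carries
-- (-1)^{n_1+…+n_{r-1}+k}, whose surplus (-1)^k is cancelled by the explicit
-- (-1)^k because ((-1)^k)^2 = 1.
module Submission where

open import Defs
open import Level using (Level)
open import Data.Nat as ℕ using (ℕ; zero; suc)
open import Data.Nat.Combinatorics using (_C_)
open import Data.Fin using (Fin; fromℕ)
open import Data.Vec.Functional using (init; last; updateAt)
open import Data.Rational using (ℚ)
open import Data.Rational.Properties using (+-*-rawRing)
open import Algebra.Bundles using (CommutativeRing)
open import Algebra.Morphism.Structures using (module RingMorphisms)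
open import Relation.Binary.PropositionalEquality as ≡ using (_≡_)
import Data.Fin as Fin
import Data.Nat.Properties as ℕ
import Algebra.Properties.Ring as RingProperties
import Algebra.Properties.Semiring.Exp as SemiringExp
import Algebra.Solver.CommutativeMonoid as CommutativeMonoidSolver
import Relation.Binary.Reasoning.Setoid as SetoidReasoning

module ZetaSigns {c ℓ : Level} (R : CommutativeRing c ℓ) (ι : ℚ → CommutativeRing.Carrier R) where
  open CommutativeRing R
  open QAlg R ι
  open RingProperties ring using (-1*x≈-x; -‿involutive)
  open SemiringExp semiring using (_^_; ^-homo-*)
  open CommutativeMonoidSolver *-commutativeMonoid using (solve; _⊜_; _⊕_)
  open SetoidReasoning setoid

  sumFin-init-last : ∀ k (f : Fin (suc k) → ℕ) →
                     sumFin (suc k) f ≡ sumFin k (init f) ℕ.+ last f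
  sumFin-init-last zero    f = ℕ.+-comm (f Fin.zero) 0
  sumFin-init-last (suc k) f =
    ≡.trans (≡.cong (f Fin.zero ℕ.+_) (sumFin-init-last k (λ i → f (Fin.suc i))))
            (≡.sym (ℕ.+-assoc (f Fin.zero) _ _))

  sumFin-updateAt-last : ∀ k (f : Fin (suc k) → ℕ) j →
                         sumFin (suc k) (updateAt f (fromℕ k) (ℕ._+ j)) ≡ sumFin (suc k) f ℕ.+ j
  sumFin-updateAt-last zero    f j =
    ≡.trans (ℕ.+-identityʳ _) (≡.cong (ℕ._+ j) (≡.sym (ℕ.+-identityʳ _)))
  sumFin-updateAt-last (suc k) f j =
    ≡.trans (≡.cong (f Fin.zero ℕ.+_) (sumFin-updateAt-last k (λ i → f (Fin.suc i)) j))
            (≡.sym (ℕ.+-assoc (f Fin.zero) _ _))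

  sumTo-cong : ∀ n {f g : ℕ → Carrier} → (∀ i → f i ≈ g i) → sumTo n f ≈ sumTo n g
  sumTo-cong zero    f≈g = f≈g 0
  sumTo-cong (suc n) f≈g = +-cong (sumTo-cong n f≈g) (f≈g (suc n))

  *-distribˡ-sumTo : ∀ n a (f : ℕ → Carrier) → a * sumTo n f ≈ sumTo n (λ i → a * f i)
  *-distribˡ-sumTo zero    a f = refl
  *-distribˡ-sumTo (suc n) a f = trans (distribˡ a _ _) (+-congʳ (*-distribˡ-sumTo n a f))

  pow≡^ : ∀ x n → pow x n ≡ x ^ n
  pow≡^ x zero    = ≡.refl
  pow≡^ x (suc n) = ≡.cong (x *_) (pow≡^ x n)

  sgn-homo-+ : ∀ a b → sgn (a ℕ.+ b) ≈ sgn a * sgn b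
  sgn-homo-+ a b rewrite pow≡^ (- 1#) (a ℕ.+ b) | pow≡^ (- 1#) a | pow≡^ (- 1#) b =
    ^-homo-* (- 1#) a b

  sgn-square : ∀ k → sgn k * sgn k ≈ 1#
  sgn-square zero    = *-identityˡ 1#
  sgn-square (suc k) = begin
    (- 1# * sgn k) * (- 1# * sgn k) ≈⟨ solve 2 (λ m s → (m ⊕ s) ⊕ (m ⊕ s) ⊜ (m ⊕ m) ⊕ (s ⊕ s)) refl (- 1#) (sgn k) ⟩
    (- 1# * - 1#) * (sgn k * sgn k) ≈⟨ *-cong (trans (-1*x≈-x (- 1#)) (-‿involutive 1#)) (sgn-square k) ⟩
    1# * 1#                         ≈⟨ *-identityˡ 1# ⟩
    1#                              ∎

  sgn-sumFin : ∀ k (n : Fin (suc k) → ℕ) →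
               sgn (sumFin (suc k) n) ≈ sgn (last n) * sgn (sumFin k (init n))
  sgn-sumFin k n = begin
    sgn (sumFin (suc k) n)                    ≡⟨ ≡.cong sgn (sumFin-init-last k n) ⟩
    sgn (sumFin k (init n) ℕ.+ last n)        ≈⟨ sgn-homo-+ (sumFin k (init n)) (last n) ⟩
    sgn (sumFin k (init n)) * sgn (last n)    ≈⟨ *-comm _ _ ⟩
    sgn (last n) * sgn (sumFin k (init n))    ∎

  zeta-updateAt-last : ∀ k (n : Fin (suc k) → ℕ) z j →
    zeta k (updateAt n (fromℕ k) (ℕ._+ j)) z ≈
      sgn j * sgn (sumFin (suc k) n) * V k (updateAt n (fromℕ k) (ℕ._+ j)) z
  zeta-updateAt-last k n z j = *-congʳ (begin
    sgn (sumFin (suc k) (updateAt n (fromℕ k) (ℕ._+ j))) ≡⟨ ≡.cong sgn (sumFin-updateAt-last k n j) ⟩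
    sgn (sumFin (suc k) n ℕ.+ j)                         ≈⟨ sgn-homo-+ (sumFin (suc k) n) j ⟩
    sgn (sumFin (suc k) n) * sgn j                       ≈⟨ *-comm _ _ ⟩
    sgn j * sgn (sumFin (suc k) n)                       ∎)

  sgn-cancel : ∀ a k s v b → a * sgn k * (sgn k * s * v) * b ≈ s * (a * b * v)
  sgn-cancel a k s v b = begin
    a * sgn k * (sgn k * s * v) * b   ≈⟨ solve 5 (λ a t s v b → ((a ⊕ t) ⊕ ((t ⊕ s) ⊕ v)) ⊕ b
                                                              ⊜ (t ⊕ t) ⊕ (s ⊕ ((a ⊕ b) ⊕ v))) refl a (sgn k) s v b ⟩
    sgn k * sgn k * (s * (a * b * v)) ≈⟨ *-congʳ (sgn-square k) ⟩
    1# * (s * (a * b * v))            ≈⟨ *-identityˡ _ ⟩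
    s * (a * b * v)                   ∎

theorem3 : {c ℓ : Level} (R : CommutativeRing c ℓ) (ι : ℚ → CommutativeRing.Carrier R) →
    RingMorphisms.IsRingHomomorphism +-*-rawRing (CommutativeRing.rawRing R) ι →
    let open CommutativeRing R
        open QAlg R ι
    in (m : ℕ) (n : Fin (suc (suc m)) → ℕ) (z : Fin (suc (suc m)) → Carrier) →
       zeta (suc m) n z ≈
         sgn (last n) * inv1+ (last n) *
         sumTo (suc (last n)) (λ k →
           nat (suc (last n) C k) * sgn k *
           zeta m (updateAt (init n) (fromℕ m) (λ x → x ℕ.+ k)) (init z) *
           bernPoly (suc (last n) ℕ.∸ k) (last z))
theorem3 R ι _ m n z = begin
  sgn (sumFin (suc (suc m)) n) * (inv1+ N * sumTo (suc N) term)
    ≈⟨ *-congʳ (sgn-sumFin (suc m) n) ⟩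
  sgn N * σ * (inv1+ N * sumTo (suc N) term)
    ≈⟨ solve 4 (λ t s i Σ → (t ⊕ s) ⊕ (i ⊕ Σ) ⊜ (t ⊕ i) ⊕ (s ⊕ Σ)) refl (sgn N) σ (inv1+ N) _ ⟩
  sgn N * inv1+ N * (σ * sumTo (suc N) term)
    ≈⟨ *-congˡ (*-distribˡ-sumTo (suc N) σ term) ⟩
  sgn N * inv1+ N * sumTo (suc N) (λ k → σ * term k)
    ≈⟨ *-congˡ (sumTo-cong (suc N) λ k →
         sym (trans (*-congʳ (*-congˡ (zeta-updateAt-last m (init n) (init z) k))) (sgn-cancel _ k σ _ _))) ⟩
  sgn N * inv1+ N * sumTo (suc N) (λ k →
    nat (suc N C k) * sgn k * zeta m (shift k) (init z) * bernPoly (suc N ℕ.∸ k) (last z)) ∎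
  where
  open CommutativeRing R
  open QAlg R ι
  open ZetaSigns R ι
  open CommutativeMonoidSolver *-commutativeMonoid using (solve; _⊜_; _⊕_)
  open SetoidReasoning setoid
  N : ℕ
  N = last n
  σ : Carrier
  σ = sgn (sumFin (suc m) (init n))
  shift : ℕ → Fin (suc m) → ℕ
  shift k = updateAt (init n) (fromℕ m) (ℕ._+ k)
  term : ℕ → Carrier
  term k = nat (suc N C k) * bernPoly (suc N ℕ.∸ k) (last z) * V m (shift k) (init z)
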